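{- Let $G$ be a non-elementary block graph which is not tagged. Then for every pair of distinct vertices $x,y$ of $G$, either $(x,y)\in\mathcal{P}(G)$ or $|\mathcal{D}_G(x,y)|\ge|G|-1$, where $|G|$ is the number of vertices of $G$.
   Context: Graphs are simple and connected; $d$ is the shortest-path distance. For distinct vertices $x,y$, $\mathcal{D}_G(x,y)=\{z\in V(G): d(x,z)\neq d(y,z)\}$. A block graph is a graph obtained by starting with a complete graph $K_{n_1}$, $n_1\ge2$, and repeatedly (finitely many times, at least once) adding a complete graph $K_{n_i}$, $n_i\ge2$, identifying one of its vertices with one vertex of the graph built so far (equivalently, a finite connected graph whose blocks are all complete). It is non-elementary if it is neither a complete graph nor a path. It is tagged if there exist a maximal complete subgraph $K_r$ with $r\ge3$ and two vertices $u,v\in K_r$ with $\deg(u)=\deg(v)=r-1$. For a vertex $v$ and positive integer $m$, $S(v,m)=\{w: d(v,w)=m\}$. A vertex separator is a set of vertices whose removal disconnects $G$. For distinct $v,v'$, a common separating subset of their $m$-spheres is a set $S\subseteq S(v,m)\cap S(v',m)$ which is a vertex separator such that some component of $G\setminus S$ contains neither $v$ nor $v'$. $\mathcal{P}(G)$ is the set of ordered pairs of distinct vertices $(v,v')$ whose $m$-spheres have a common separating subset for some positive integer $m$. -}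

module Defs where

open import Data.Nat using (ℕ; zero; suc; _+_; _∸_; _≤_)
open import Data.Fin using (Fin; splitAt; toℕ; _≟_)
open import Data.Fin.Subset using (Subset; _∈_; _∉_; ∣_∣)
open import Data.Fin.Permutation using (Permutation′; _⟨$⟩ʳ_)
open import Data.Vec using (tabulate)
open import Data.Bool using (Bool; true; false; not)
open import Data.Sum using (_⊎_; inj₁; inj₂)
open import Data.Product using (Σ; ∃; _×_; _,_)
open import Relation.Binary.PropositionalEquality using (_≡_; _≢_)
open import Relation.Nullary using (¬_)
open import Relation.Nullary.Decidable using (⌊_⌋)
open import Function.Bundles using (_⇔_)

Adj : ℕ → Set
Adj n = Fin n → Fin n → Bool

E : ∀ {n} → Adj n → Fin n → Fin n → Set
E A x y = A x y ≡ true

Iso : ∀ {n} → Adj n → Adj n → Set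
Iso {n} B A = Σ (Permutation′ n) λ σ → ∀ x y → A (σ ⟨$⟩ʳ x) (σ ⟨$⟩ʳ y) ≡ B x y

complete : (m : ℕ) → Adj m
complete m i j = not ⌊ i ≟ j ⌋

-- Glue a complete graph K_{k+1} onto A by identifying one of its vertices with v:
-- the k new vertices are the last k elements of Fin (n + k).
glueK : ∀ {n} → Adj n → Fin n → (k : ℕ) → Adj (n + k)
glueK {n} A v k i j with splitAt n i | splitAt n j
... | inj₁ a | inj₁ b = A a b
... | inj₁ a | inj₂ _ = ⌊ a ≟ v ⌋
... | inj₂ _ | inj₁ b = ⌊ b ≟ v ⌋
... | inj₂ p | inj₂ q = not ⌊ p ≟ q ⌋

data Built : (n : ℕ) → Adj n → ℕ → Set where
  base : ∀ m → 2 ≤ m → Built m (complete m) 0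
  glue : ∀ {n A s} → Built n A s → (v : Fin n) → (k : ℕ) → 1 ≤ k →
         Built (n + k) (glueK A v k) (suc s)

IsBlockGraph : ∀ {n} → Adj n → Set
IsBlockGraph {n} A = ∃ λ s → Σ (Adj n) λ B → Built n B (suc s) × Iso B A

data Walk {n} (A : Adj n) : Fin n → Fin n → ℕ → Set where
  here : ∀ x → Walk A x x 0
  step : ∀ {x y z k} → E A x y → Walk A y z k → Walk A x z (suc k)

Dist : ∀ {n} → Adj n → Fin n → Fin n → ℕ → Set
Dist A x y k = Walk A x y k × (∀ j → Walk A x y j → k ≤ j)

InD : ∀ {n} → Adj n → Fin n → Fin n → Fin n → Set
InD A x y z = ∀ a b → Dist A x z a → Dist A y z b → a ≢ b

Complete : ∀ {n} → Adj n → Set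
Complete A = ∀ x y → x ≢ y → E A x y

IsPath : ∀ {n} → Adj n → Set
IsPath {n} A = Σ (Permutation′ n) λ σ → ∀ x y →
  E A x y ⇔ (suc (toℕ (σ ⟨$⟩ʳ x)) ≡ toℕ (σ ⟨$⟩ʳ y) ⊎ suc (toℕ (σ ⟨$⟩ʳ y)) ≡ toℕ (σ ⟨$⟩ʳ x))

NonElementary : ∀ {n} → Adj n → Set
NonElementary A = ¬ Complete A × ¬ IsPath A

deg : ∀ {n} → Adj n → Fin n → ℕ
deg A v = ∣ tabulate (A v) ∣

IsClique : ∀ {n} → Adj n → Subset n → Set
IsClique A S = ∀ a b → a ∈ S → b ∈ S → a ≢ b → E A a b

IsMaxClique : ∀ {n} → Adj n → Subset n → Set
IsMaxClique A S = IsClique A S × (∀ w → w ∉ S → ¬ (∀ a → a ∈ S → E A w a))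

Tagged : ∀ {n} → Adj n → Set
Tagged A = Σ _ λ S → IsMaxClique A S × 3 ≤ ∣ S ∣ ×
  Σ _ λ u → Σ _ λ v → u ∈ S × v ∈ S × u ≢ v ×
    deg A u ≡ ∣ S ∣ ∸ 1 × deg A v ≡ ∣ S ∣ ∸ 1

data Reach {n} (A : Adj n) (S : Subset n) : Fin n → Fin n → Set where
  here : ∀ {a} → a ∉ S → Reach A S a a
  step : ∀ {a b c} → a ∉ S → E A a b → Reach A S b c → Reach A S a c

IsSeparator : ∀ {n} → Adj n → Subset n → Set
IsSeparator A S = Σ _ λ a → Σ _ λ b → a ∉ S × b ∉ S × ¬ Reach A S a b

CommonSep : ∀ {n} → Adj n → Fin n → Fin n → ℕ → Subset n → Set
CommonSep A v v' m S =
  (∀ z → z ∈ S → Dist A v z m × Dist A v' z m) × IsSeparator A S ×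
  Σ _ λ w → w ∉ S × ¬ Reach A S w v × ¬ Reach A S w v'

InP : ∀ {n} → Adj n → Fin n → Fin n → Set
InP A v v' = v ≢ v' × Σ ℕ λ m → 1 ≤ m × Σ _ λ S → CommonSep A v v' m S

module Submission where

-- Call z equidistant when d(x,z) = d(y,z); if at most one vertex is equidistant, all others resolve x
-- and y. Otherwise let z be an equidistant vertex nearest to x, with neighbours a and b one step closer
-- to x and to y. In a block graph the middle vertex of an induced path separates its ends. So if a and
-- b are non-adjacent, z separates x from y, any other equidistant vertex lies in a third component of
-- G ∖ z, and {z} is a common separating subset of the spheres of x and y. If a and b are adjacent, the
-- block K through ab consists of a, b and their common neighbours, which are all equidistant. A vertex
-- outside K is closer to x or to y according as its gate into K is a or b; if the gate is a common
-- neighbour c, then c separates it from x and y. Hence either an equidistant vertex of K has a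
-- neighbour outside K, again giving a separating singleton, or two equidistant vertices of K have all
-- their neighbours in K, so degree ∣K∣ − 1, and G is tagged.

open import Defs
open import Data.Bool using (Bool; true)
import Data.Bool.Properties as Bool
open import Data.Fin using (Fin; zero; suc; splitAt; _↑ˡ_; _↑ʳ_; _≟_)
open import Data.Fin.Properties using (any?; splitAt-↑ˡ; splitAt-↑ʳ; splitAt⁻¹-↑ˡ; splitAt⁻¹-↑ʳ)
open import Data.Fin.Permutation using (_⟨$⟩ʳ_; _⟨$⟩ˡ_; inverseʳ)
open import Data.Fin.Subset using (Subset; _∈_; _∉_; ∣_∣; ⁅_⁆; _-_; _⊆_; ∁; ⊤; inside; outside)
open import Data.Fin.Subset.Properties
  using (_∈?_; x∈⁅x⁆; x∈⁅y⁆⇒x≡y; x≢y⇒x∉⁅y⁆; x∉⁅y⁆⇒x≢y; ∣⁅x⁆∣≡1; ∣⊤∣≡n; ∣∁p∣≡n∸∣p∣;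
         x∈∁p⇒x∉p; p⊆q⇒∣p∣≤∣q∣; p─⊥≡p; x∈p⇒∣p-x∣<∣p∣; x∈p∧x≢y⇒x∈p-y; ⊆-antisym; p─q⊆p)
open import Data.Nat using (ℕ; zero; suc; _+_; _∸_; _≤_; _<_; z≤n; s≤s; s≤s⁻¹) renaming (_≟_ to _≟ℕ_)
open import Data.Nat.Properties hiding (_≟_)
open import Data.Product using (Σ; ∃; _×_; _,_; proj₁; proj₂)
open import Data.Sum using (_⊎_; inj₁; inj₂; [_,_]′; map₂)
open import Data.Vec using (tabulate; _∷_; here; there)
open import Data.Vec.Properties using (lookup∘tabulate; []=⇒lookup; lookup⇒[]=)
open import Function using (_∘_; id; const)
open import Function.Definitions using (Injective)
open import Relation.Binary.PropositionalEquality
open import Relation.Nullary using (¬_; Dec; yes; no; does; contradiction)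
open import Relation.Nullary.Decidable using (⌊_⌋; _×-dec_; _⊎-dec_; ¬?; dec-true; decidable-stable)
open import Relation.Unary using (Pred; Decidable)

leastℕ : ∀ {p} {P : Pred ℕ p} → Decidable P → ∀ {K} → P K →
         Σ ℕ λ k → P k × ∀ {j} → P j → k ≤ j
leastℕ P? {K} pK with P? 0
... | yes p0 = 0 , p0 , λ _ → z≤n
leastℕ P? {zero}  pK | no ¬p0 = contradiction pK ¬p0
leastℕ P? {suc K} pK | no ¬p0 with leastℕ (P? ∘ suc) pK
... | k , pk , least = suc k , pk , λ { {zero} p0 → contradiction p0 ¬p0 ; {suc j} pj → s≤s (least pj) }

argmin : ∀ {n p} {P : Pred (Fin n) p} (f : Fin n → ℕ) → Decidable P → ∃ P →
         Σ (Fin n) λ z → P z × ∀ {w} → P w → f z ≤ f w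
argmin f P? (w , pw) with leastℕ (λ k → any? (λ z → P? z ×-dec f z ≟ℕ k)) (w , pw , refl)
... | _ , (z , pz , refl) , least = z , pz , λ {w} pw → least (w , pw , refl)

witness-≢ : ∀ {n p} {P : Pred (Fin n) p} {z₁ z₂} → P z₁ → P z₂ → z₁ ≢ z₂ → ∀ z → ∃ λ z′ → P z′ × z′ ≢ z
witness-≢ {z₁ = z₁} {z₂} pz₁ pz₂ z₁≢z₂ z with z₁ ≟ z
... | yes refl = z₂ , pz₂ , ≢-sym z₁≢z₂
... | no z₁≢z  = z₁ , pz₁ , z₁≢z

≡∧≡suc⇒< : ∀ {i j m} → i ≡ m → j ≡ suc m → i < j
≡∧≡suc⇒< refl refl = n<1+n _

⌊≟⌋⇒≡ : ∀ {n} {i j : Fin n} → ⌊ i ≟ j ⌋ ≡ true → i ≡ j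
⌊≟⌋⇒≡ {i = i} {j} eq with i ≟ j
... | yes i≡j = i≡j

⌊≟⌋-refl : ∀ {n} (i : Fin n) → ⌊ i ≟ i ⌋ ≡ true
⌊≟⌋-refl i with i ≟ i
... | yes _ = refl
... | no i≢i = contradiction refl i≢i

∈-tabulate⁺ : ∀ {n} {f : Fin n → Bool} {i : Fin n} → f i ≡ true → i ∈ tabulate f
∈-tabulate⁺ {f = f} {i} fi = lookup⇒[]= i (tabulate f) (trans (lookup∘tabulate f i) fi)

∈-tabulate⁻ : ∀ {n} {f : Fin n → Bool} {i : Fin n} → i ∈ tabulate f → f i ≡ true
∈-tabulate⁻ {f = f} {i} i∈ = trans (sym (lookup∘tabulate f i)) ([]=⇒lookup i∈)

toSubset : ∀ {n p} {P : Pred (Fin n) p} → Decidable P → Subset n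
toSubset P? = tabulate (does ∘ P?)

module _ {n p} {P : Pred (Fin n) p} (P? : Decidable P) where

  ∈-toSubset⁺ : ∀ {i} → P i → i ∈ toSubset P?
  ∈-toSubset⁺ {i} pi = ∈-tabulate⁺ (dec-true (P? i) pi)

  ∈-toSubset⁻ : ∀ {i} → i ∈ toSubset P? → P i
  ∈-toSubset⁻ {i} i∈ with P? i | ∈-tabulate⁻ {f = does ∘ P?} i∈
  ... | yes pi | _ = pi

x∉p-x : ∀ {n} {x : Fin n} (p : Subset n) → x ∉ p - x
x∉p-x {x = zero} (_ ∷ p) ()
x∉p-x {x = suc x} (_ ∷ p) (there x∈) = x∉p-x p x∈

∣p∣≡1+∣p-x∣ : ∀ {n} {x : Fin n} {p : Subset n} → x ∈ p → ∣ p ∣ ≡ suc ∣ p - x ∣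
∣p∣≡1+∣p-x∣ {x = zero}  {p = inside ∷ p}  here        = cong (suc ∘ ∣_∣) (sym (p─⊥≡p p))
∣p∣≡1+∣p-x∣ {x = suc x} {p = inside ∷ p}  (there x∈p) = cong suc (∣p∣≡1+∣p-x∣ x∈p)
∣p∣≡1+∣p-x∣ {x = suc x} {p = outside ∷ p} (there x∈p) = ∣p∣≡1+∣p-x∣ x∈p

3≤∣p∣ : ∀ {n} {a b c : Fin n} {p : Subset n} → a ∈ p → b ∈ p → c ∈ p → a ≢ b → a ≢ c → b ≢ c → 3 ≤ ∣ p ∣
3≤∣p∣ {a = a} {b} {c} {p} a∈p b∈p c∈p a≢b a≢c b≢c =
  ≤-<-trans (≤-<-trans (≤-<-trans z≤n (x∈p⇒∣p-x∣<∣p∣ c∈p-a-b)) (x∈p⇒∣p-x∣<∣p∣ b∈p-a)) (x∈p⇒∣p-x∣<∣p∣ a∈p)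
  where
  b∈p-a : b ∈ p - a
  b∈p-a = x∈p∧x≢y⇒x∈p-y b∈p (≢-sym a≢b)
  c∈p-a-b : c ∈ p - a - b
  c∈p-a-b = x∈p∧x≢y⇒x∈p-y (x∈p∧x≢y⇒x∈p-y c∈p (≢-sym a≢c)) (≢-sym b≢c)

n∸1≤∣p∣ : ∀ {n} {p : Subset n} → (∀ {i j} → i ∉ p → j ∉ p → i ≡ j) → n ∸ 1 ≤ ∣ p ∣
n∸1≤∣p∣ {n} {p} unique with any? (λ i → ¬? (i ∈? p))
... | yes (i , i∉p) = begin
  n ∸ 1           ≡⟨ cong (n ∸_) (sym (∣⁅x⁆∣≡1 i)) ⟩
  n ∸ ∣ ⁅ i ⁆ ∣   ≡⟨ sym (∣∁p∣≡n∸∣p∣ ⁅ i ⁆) ⟩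
  ∣ ∁ ⁅ i ⁆ ∣     ≤⟨ p⊆q⇒∣p∣≤∣q∣ ∁⁅i⁆⊆p ⟩
  ∣ p ∣           ∎
  where
  open ≤-Reasoning
  ∁⁅i⁆⊆p : ∁ ⁅ i ⁆ ⊆ p
  ∁⁅i⁆⊆p {j} j∈∁⁅i⁆ with j ∈? p
  ... | yes j∈p = j∈p
  ... | no j∉p = contradiction (subst (_∈ ⁅ i ⁆) (sym (unique j∉p i∉p)) (x∈⁅x⁆ i)) (x∈∁p⇒x∉p j∈∁⁅i⁆)
... | no ∄i∉p = ≤-trans (m∸n≤m n 1) (subst (_≤ ∣ p ∣) (∣⊤∣≡n n) (p⊆q⇒∣p∣≤∣q∣ ⊤⊆p))
  where
  ⊤⊆p : ⊤ ⊆ p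
  ⊤⊆p {j} _ with j ∈? p
  ... | yes j∈p = j∈p
  ... | no j∉p = contradiction (j , j∉p) ∄i∉p

E? : ∀ {n} (A : Adj n) a b → Dec (E A a b)
E? A a b = A a b Bool.≟ true

Separates : ∀ {n} → Adj n → Fin n → Fin n → Fin n → Set
Separates A c u v = ¬ Reach A ⁅ c ⁆ u v

module _ {n} {A : Adj n} where

  _++ʷ_ : ∀ {a b c i j} → Walk A a b i → Walk A b c j → Walk A a c (i + j)
  here _   ++ʷ w′ = w′
  step e w ++ʷ w′ = step e (w ++ʷ w′)

  walk-reverse : (∀ {a b} → E A a b → E A b a) → ∀ {a b k} → Walk A a b k → Walk A b a k
  walk-reverse E-sym (here a) = here a
  walk-reverse E-sym (step {k = k} e w) =
    subst (Walk A _ _) (+-comm k 1) (walk-reverse E-sym w ++ʷ step (E-sym e) (here _))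

  walk? : ∀ k a b → Dec (Walk A a b k)
  walk? zero a b with a ≟ b
  ... | yes refl = yes (here a)
  ... | no a≢b   = no λ { (here _) → a≢b refl }
  walk? (suc k) a b with any? (λ c → E? A a c ×-dec walk? k c b)
  ... | yes (c , e , w) = yes (step e w)
  ... | no ∄c           = no λ { (step e w) → ∄c (_ , e , w) }

  reach-start∉ : ∀ {S a b} → Reach A S a b → a ∉ S
  reach-start∉ (here a∉S)     = a∉S
  reach-start∉ (step a∉S _ _) = a∉S

  reach-end∉ : ∀ {S a b} → Reach A S a b → b ∉ S
  reach-end∉ (here b∉S)   = b∉S
  reach-end∉ (step _ _ r) = reach-end∉ r

  reach-trans : ∀ {S a b c} → Reach A S a b → Reach A S b c → Reach A S a c
  reach-trans (here _)     r′ = r′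
  reach-trans (step a∉ e r) r′ = step a∉ e (reach-trans r r′)

  reach-sym : (∀ {a b} → E A a b → E A b a) → ∀ {S a b} → Reach A S a b → Reach A S b a
  reach-sym E-sym (here a∉)         = here a∉
  reach-sym E-sym (step a∉ e r) =
    reach-trans (reach-sym E-sym r) (step (reach-start∉ r) (E-sym e) (here a∉))

module _ {m n} {A : Adj m} {B : Adj n} (f : Fin m → Fin n)
         (f-edge : ∀ {a b} → E A a b → E B (f a) (f b)) where

  walk-map : ∀ {a b k} → Walk A a b k → Walk B (f a) (f b) k
  walk-map (here a)   = here (f a)
  walk-map (step e w) = step (f-edge e) (walk-map w)

  module _ (f-inj : Injective _≡_ _≡_ f) where

    ∉⁅⁆-map : ∀ {c a} → a ∉ ⁅ c ⁆ → f a ∉ ⁅ f c ⁆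
    ∉⁅⁆-map a∉ = x≢y⇒x∉⁅y⁆ (x∉⁅y⁆⇒x≢y a∉ ∘ f-inj)

    reach-map : ∀ {c a b} → Reach A ⁅ c ⁆ a b → Reach B ⁅ f c ⁆ (f a) (f b)
    reach-map (here a∉)     = here (∉⁅⁆-map a∉)
    reach-map (step a∉ e r) = step (∉⁅⁆-map a∉) (f-edge e) (reach-map r)

record BlockGraph {n} (A : Adj n) : Set where
  field
    E-sym     : ∀ {a b} → E A a b → E A b a
    E-irrefl  : ∀ a → ¬ E A a a
    connected : ∀ a b → ∃ (Walk A a b)
    cut       : ∀ {a c b} → E A a c → E A c b → a ≢ b → ¬ E A a b → Separates A c a b

complete-E⁺ : ∀ {m} {i j : Fin m} → i ≢ j → E (complete m) i j
complete-E⁺ {i = i} {j} i≢j with i ≟ j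
... | yes i≡j = contradiction i≡j i≢j
... | no _    = refl

complete-E⁻ : ∀ {m} {i j : Fin m} → E (complete m) i j → i ≢ j
complete-E⁻ {i = i} e refl = Bool.not-¬ (sym (⌊≟⌋-refl i)) (sym e)

complete-blockGraph : ∀ m → BlockGraph (complete m)
complete-blockGraph m = record
  { E-sym     = complete-E⁺ ∘ ≢-sym ∘ complete-E⁻
  ; E-irrefl  = λ a e → complete-E⁻ e refl
  ; connected = connected
  ; cut       = λ _ _ a≢b ¬eab _ → ¬eab (complete-E⁺ a≢b)
  }
  where
  connected : ∀ a b → ∃ (Walk (complete m) a b)
  connected a b with a ≟ b
  ... | yes refl = 0 , here a
  ... | no a≢b   = 1 , step (complete-E⁺ a≢b) (here b)

module Glue {n} (A : Adj n) (v : Fin n) (k : ℕ) (G : BlockGraph A) where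
  open BlockGraph G

  G′ : Adj (n + k)
  G′ = glueK A v k

  data View : Fin (n + k) → Set where
    old : ∀ a → View (a ↑ˡ k)
    new : ∀ p → View (n ↑ʳ p)

  view : ∀ i → View i
  view i with splitAt n i in eq
  ... | inj₁ a = subst View (splitAt⁻¹-↑ˡ eq) (old a)
  ... | inj₂ p = subst View (splitAt⁻¹-↑ʳ eq) (new p)

  old-old : ∀ {a b} → G′ (a ↑ˡ k) (b ↑ˡ k) ≡ A a b
  old-old {a} {b} rewrite splitAt-↑ˡ n a k | splitAt-↑ˡ n b k = refl

  old-new : ∀ {a q} → G′ (a ↑ˡ k) (n ↑ʳ q) ≡ ⌊ a ≟ v ⌋
  old-new {a} {q} rewrite splitAt-↑ˡ n a k | splitAt-↑ʳ n k q = refl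

  new-old : ∀ {p b} → G′ (n ↑ʳ p) (b ↑ˡ k) ≡ ⌊ b ≟ v ⌋
  new-old {p} {b} rewrite splitAt-↑ʳ n k p | splitAt-↑ˡ n b k = refl

  new-new : ∀ {p q} → G′ (n ↑ʳ p) (n ↑ʳ q) ≡ complete k p q
  new-new {p} {q} rewrite splitAt-↑ʳ n k p | splitAt-↑ʳ n k q = refl

  old-E⁺ : ∀ {a b} → E A a b → E G′ (a ↑ˡ k) (b ↑ˡ k)
  old-E⁺ = trans old-old

  old-E⁻ : ∀ {a b} → E G′ (a ↑ˡ k) (b ↑ˡ k) → E A a b
  old-E⁻ = trans (sym old-old)

  old-new-E⁻ : ∀ {a q} → E G′ (a ↑ˡ k) (n ↑ʳ q) → a ≡ v
  old-new-E⁻ e = ⌊≟⌋⇒≡ (trans (sym old-new) e)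

  new-old-E⁻ : ∀ {p b} → E G′ (n ↑ʳ p) (b ↑ˡ k) → b ≡ v
  new-old-E⁻ e = ⌊≟⌋⇒≡ (trans (sym new-old) e)

  new-new-E⁺ : ∀ {p q} → p ≢ q → E G′ (n ↑ʳ p) (n ↑ʳ q)
  new-new-E⁺ p≢q = trans new-new (complete-E⁺ p≢q)

  new-new-E⁻ : ∀ {p q} → E G′ (n ↑ʳ p) (n ↑ʳ q) → p ≢ q
  new-new-E⁻ e = complete-E⁻ (trans (sym new-new) e)

  v-new-E : ∀ {q} → E G′ (v ↑ˡ k) (n ↑ʳ q)
  v-new-E = trans old-new (⌊≟⌋-refl v)

  new-v-E : ∀ {p} → E G′ (n ↑ʳ p) (v ↑ˡ k)
  new-v-E = trans new-old (⌊≟⌋-refl v)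

  G′-sym : ∀ {i j} → E G′ i j → E G′ j i
  G′-sym {i} {j} e with view i | view j
  ... | old a | old b = old-E⁺ (E-sym (old-E⁻ e))
  ... | old a | new q rewrite old-new-E⁻ e = new-v-E
  ... | new p | old b rewrite new-old-E⁻ e = v-new-E
  ... | new p | new q = new-new-E⁺ (≢-sym (new-new-E⁻ e))

  G′-irrefl : ∀ i → ¬ E G′ i i
  G′-irrefl i e with view i
  ... | old a = E-irrefl a (old-E⁻ e)
  ... | new p = new-new-E⁻ e refl

  new-neighbours-adjacent : ∀ {p i j} → E G′ (n ↑ʳ p) i → E G′ (n ↑ʳ p) j → i ≢ j → E G′ i j
  new-neighbours-adjacent {i = i} {j} ei ej i≢j with view i | view j
  ... | old a | old b = contradiction (cong (_↑ˡ k) (trans (new-old-E⁻ ei) (sym (new-old-E⁻ ej)))) i≢j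
  ... | old a | new q rewrite new-old-E⁻ ei = v-new-E
  ... | new p | old b rewrite new-old-E⁻ ej = new-v-E
  ... | new p | new q = new-new-E⁺ (i≢j ∘ cong (n ↑ʳ_))

  anchor : Fin (n + k) → Fin n
  anchor i = [ id , const v ]′ (splitAt n i)

  anchor-old : ∀ {a} → anchor (a ↑ˡ k) ≡ a
  anchor-old {a} = cong [ id , const v ]′ (splitAt-↑ˡ n a k)

  anchor-new : ∀ {p} → anchor (n ↑ʳ p) ≡ v
  anchor-new {p} = cong [ id , const v ]′ (splitAt-↑ʳ n k p)

  to-anchor : ∀ i → ∃ (Walk G′ i (anchor i ↑ˡ k))
  to-anchor i with view i
  ... | old a = 0 , subst (λ b → Walk G′ (a ↑ˡ k) (b ↑ˡ k) 0) (sym anchor-old) (here _)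
  ... | new p = 1 , subst (λ b → Walk G′ (n ↑ʳ p) (b ↑ˡ k) 1) (sym anchor-new) (step new-v-E (here _))

  G′-connected : ∀ i j → ∃ (Walk G′ i j)
  G′-connected i j =
    _ , proj₂ (to-anchor i)
        ++ʷ (walk-map (_↑ˡ k) old-E⁺ (proj₂ (connected (anchor i) (anchor j)))
        ++ʷ walk-reverse G′-sym (proj₂ (to-anchor j)))

  anchor-edge : ∀ {i j} → E G′ i j → anchor i ≡ anchor j ⊎ E A (anchor i) (anchor j)
  anchor-edge {i} {j} e with view i | view j
  ... | old a | old b rewrite anchor-old {a} | anchor-old {b} = inj₂ (old-E⁻ e)
  ... | old a | new q rewrite anchor-old {a} | anchor-new {q} = inj₁ (old-new-E⁻ e)
  ... | new p | old b rewrite anchor-new {p} | anchor-old {b} = inj₁ (sym (new-old-E⁻ e))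
  ... | new p | new q rewrite anchor-new {p} | anchor-new {q} = inj₁ refl

  old-∉ : ∀ {a c : Fin n} → a ↑ˡ k ∉ ⁅ c ↑ˡ k ⁆ → a ∉ ⁅ c ⁆
  old-∉ a∉ = x≢y⇒x∉⁅y⁆ (x∉⁅y⁆⇒x≢y a∉ ∘ cong (_↑ˡ k))

  anchor-∉ : ∀ {c : Fin n} {i j} → E G′ i j → j ∉ ⁅ c ↑ˡ k ⁆ → anchor i ∉ ⁅ c ⁆ → anchor j ∉ ⁅ c ⁆
  anchor-∉ {c} {i} {j} e j∉ i∉ with view j
  ... | old b rewrite anchor-old {b} = old-∉ j∉
  ... | new q with view i
  ...   | old a rewrite anchor-new {q} | old-new-E⁻ e = subst (_∉ ⁅ c ⁆) anchor-old i∉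
  ...   | new p rewrite anchor-new {q} = subst (_∉ ⁅ c ⁆) anchor-new i∉

  reach-anchor : ∀ {c : Fin n} {i j} → Reach G′ ⁅ c ↑ˡ k ⁆ i j → anchor i ∉ ⁅ c ⁆ →
                 Reach A ⁅ c ⁆ (anchor i) (anchor j)
  reach-anchor (here _) i∉ = here i∉
  reach-anchor {c} {j = j} (step _ e r) i∉
    with anchor-edge e | reach-anchor r (anchor-∉ e (reach-start∉ r) i∉)
  ... | inj₁ eq | r′ = subst (λ w → Reach A ⁅ c ⁆ w (anchor j)) (sym eq) r′
  ... | inj₂ e′ | r′ = step i∉ e′ r′

  reach-anchor-old : ∀ {c a : Fin n} {j} → Reach G′ ⁅ c ↑ˡ k ⁆ (a ↑ˡ k) j → Reach A ⁅ c ⁆ a (anchor j)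
  reach-anchor-old {c} {a} {j} r = subst (λ w → Reach A ⁅ c ⁆ w (anchor j)) anchor-old (reach-anchor r a∉)
    where
    a∉ : anchor (a ↑ˡ k) ∉ ⁅ c ⁆
    a∉ = subst (_∉ ⁅ c ⁆) (sym anchor-old) (old-∉ (reach-start∉ r))

  old-cut-off-new : ∀ {c a : Fin n} {q} → E G′ (c ↑ˡ k) (n ↑ʳ q) → Separates G′ (c ↑ˡ k) (a ↑ˡ k) (n ↑ʳ q)
  old-cut-off-new {c} e r =
    reach-end∉ (reach-anchor-old r) (subst (_∈ ⁅ c ⁆) (trans (old-new-E⁻ e) (sym anchor-new)) (x∈⁅x⁆ c))

  G′-cut : ∀ {a c b} → E G′ a c → E G′ c b → a ≢ b → ¬ E G′ a b → Separates G′ c a b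
  G′-cut {a} {c} {b} eac ecb a≢b ¬eab r with view c
  ... | new p = ¬eab (new-neighbours-adjacent (G′-sym eac) ecb a≢b)
  ... | old c₀ with view a | view b
  ...   | old a₀ | old b₀ = cut (old-E⁻ eac) (old-E⁻ ecb) (a≢b ∘ cong (_↑ˡ k)) (¬eab ∘ old-E⁺)
                              (subst (Reach A ⁅ c₀ ⁆ a₀) anchor-old (reach-anchor-old r))
  ...   | old a₀ | new q  = old-cut-off-new ecb r
  ...   | new p  | old b₀ = old-cut-off-new (G′-sym eac) (reach-sym G′-sym r)
  ...   | new p  | new q  = ¬eab (new-new-E⁺ (a≢b ∘ cong (n ↑ʳ_)))

  blockGraph : BlockGraph G′
  blockGraph = record { E-sym = G′-sym ; E-irrefl = G′-irrefl ; connected = G′-connected ; cut = G′-cut }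

built-blockGraph : ∀ {n B s} → Built n B s → BlockGraph B
built-blockGraph (base m _)       = complete-blockGraph m
built-blockGraph (glue b v k _) = Glue.blockGraph _ v k (built-blockGraph b)

iso-blockGraph : ∀ {n} {A B : Adj n} → Iso B A → BlockGraph B → BlockGraph A
iso-blockGraph {n} {A} {B} (σ , σ-edge) G = record
  { E-sym     = from ∘ E-sym ∘ to
  ; E-irrefl  = λ a → E-irrefl (τ a) ∘ to
  ; connected = A-connected
  ; cut       = λ eac ecb a≢b ¬eab r →
                  cut (to eac) (to ecb) (a≢b ∘ τ-injective) (¬eab ∘ from) (reach-map τ to τ-injective r)
  }
  where
  open BlockGraph G
  τ : Fin n → Fin n
  τ = σ ⟨$⟩ˡ_
  τ-injective : Injective _≡_ _≡_ τ
  τ-injective eq = trans (sym (inverseʳ σ)) (trans (cong (σ ⟨$⟩ʳ_) eq) (inverseʳ σ))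
  A≡B∘τ : ∀ p q → A p q ≡ B (τ p) (τ q)
  A≡B∘τ p q = trans (cong₂ A (sym (inverseʳ σ)) (sym (inverseʳ σ))) (σ-edge (τ p) (τ q))
  to : ∀ {p q} → E A p q → E B (τ p) (τ q)
  to = trans (sym (A≡B∘τ _ _))
  from : ∀ {p q} → E B (τ p) (τ q) → E A p q
  from = trans (A≡B∘τ _ _)
  A-connected : ∀ a b → ∃ (Walk A a b)
  A-connected a b with connected (τ a) (τ b)
  ... | l , w = l , subst₂ (λ a′ b′ → Walk A a′ b′ l) (inverseʳ σ) (inverseʳ σ)
                      (walk-map (σ ⟨$⟩ʳ_) (trans (σ-edge _ _)) w)

isBlockGraph⇒blockGraph : ∀ {n} {A : Adj n} → IsBlockGraph A → BlockGraph A
isBlockGraph⇒blockGraph (_ , _ , built , iso) = iso-blockGraph iso (built-blockGraph built)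

module Distance {n} {A : Adj n} (E-sym : ∀ {a b} → E A a b → E A b a)
                (connected : ∀ a b → ∃ (Walk A a b)) where

  private
    shortest : ∀ a b → Σ ℕ λ k → Walk A a b k × ∀ {j} → Walk A a b j → k ≤ j
    shortest a b = leastℕ (λ k → walk? k a b) (proj₂ (connected a b))

  dist : Fin n → Fin n → ℕ
  dist a b = proj₁ (shortest a b)

  geodesic : ∀ a b → Walk A a b (dist a b)
  geodesic a b = proj₁ (proj₂ (shortest a b))

  dist-minimal : ∀ {a b k} → Walk A a b k → dist a b ≤ k
  dist-minimal {a} {b} = proj₂ (proj₂ (shortest a b))

  dist-Dist : ∀ a b → Dist A a b (dist a b)
  dist-Dist a b = geodesic a b , λ _ → dist-minimal

  Dist⇒≡dist : ∀ {a b k} → Dist A a b k → k ≡ dist a b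
  Dist⇒≡dist {a} {b} (w , minimal) = ≤-antisym (minimal _ (geodesic a b)) (dist-minimal w)

  dist-sym : ∀ a b → dist a b ≡ dist b a
  dist-sym a b = ≤-antisym (dist-minimal (walk-reverse E-sym (geodesic b a)))
                           (dist-minimal (walk-reverse E-sym (geodesic a b)))

  dist-refl : ∀ a → dist a a ≡ 0
  dist-refl a = n≤0⇒n≡0 (dist-minimal (here a))

  dist≡0⇒≡ : ∀ {a b} → dist a b ≡ 0 → a ≡ b
  dist≡0⇒≡ {a} {b} eq with dist a b | geodesic a b
  dist≡0⇒≡ refl | .0 | here _ = refl

  ≢⇒0<dist : ∀ {a b} → a ≢ b → 0 < dist a b
  ≢⇒0<dist a≢b = n≢0⇒n>0 (a≢b ∘ dist≡0⇒≡)

  dist-triangle : ∀ a b c → dist a c ≤ dist a b + dist b c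
  dist-triangle a b c = dist-minimal (geodesic a b ++ʷ geodesic b c)

  dist-step : ∀ a {b c} → E A b c → dist a c ≤ suc (dist a b)
  dist-step a {b} e = ≤-trans (dist-minimal (geodesic a b ++ʷ step e (here _))) (≤-reflexive (+-comm (dist a b) 1))

  closer-neighbour : ∀ a b {k} → dist a b ≡ suc k → ∃ λ c → E A b c × dist a c ≡ k
  closer-neighbour a b {k} eq with subst (Walk A b a) eq (walk-reverse E-sym (geodesic a b))
  ... | step {y = c} e w =
    c , e , ≤-antisym (subst (_≤ k) (dist-sym c a) (dist-minimal w))
                      (s≤s⁻¹ (subst (_≤ suc (dist a c)) eq (dist-step a (E-sym e))))

module _ {n} {A : Adj n} (G : BlockGraph A) where
  open BlockGraph G
  open Distance E-sym connected

  E⇒≢ : ∀ {a b} → E A a b → a ≢ b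
  E⇒≢ {a} e refl = E-irrefl a e

  reach-toward : ∀ {x u c} → u ≢ c → dist x u ≤ dist x c → Reach A ⁅ c ⁆ u x
  reach-toward {x} {u} {c} u≢c le = go (dist x u) refl u≢c le
    where
    go : ∀ {u} k → dist x u ≡ k → u ≢ c → k ≤ dist x c → Reach A ⁅ c ⁆ u x
    go {u} zero eq u≢c _ with dist≡0⇒≡ {x} {u} eq
    ... | refl = here (x≢y⇒x∉⁅y⁆ u≢c)
    go {u} (suc k) eq u≢c le with closer-neighbour x u eq
    ... | u′ , e , eq′ = step (x≢y⇒x∉⁅y⁆ u≢c) e (go k eq′ u′≢c (≤-trans (n≤1+n k) le))
      where
      u′≢c : u′ ≢ c
      u′≢c refl = 1+n≰n (subst (suc k ≤_) eq′ le)

  reach-toward< : ∀ {x u c} → dist x u < dist x c → Reach A ⁅ c ⁆ u x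
  reach-toward< lt = reach-toward (λ { refl → <-irrefl refl lt }) (<⇒≤ lt)

  separated⇒dist-through : ∀ {c u v} → Separates A c u v → u ≢ c → dist u c + dist c v ≤ dist u v
  separated⇒dist-through {c} sep u≢c = walk-through sep u≢c (geodesic _ _)
    where
    walk-through : ∀ {u v k} → Separates A c u v → u ≢ c → Walk A u v k → dist u c + dist c v ≤ k
    walk-through sep u≢c (here _) = contradiction (here (x≢y⇒x∉⁅y⁆ u≢c)) sep
    walk-through {u} {v} sep u≢c (step {y = u′} {k = k} e w) with u′ ≟ c
    ... | yes refl = +-mono-≤ (dist-minimal (step e (here _))) (dist-minimal w)
    ... | no u′≢c = begin
      dist u c + dist c v        ≤⟨ +-monoˡ-≤ (dist c v) (dist-minimal (step e (geodesic u′ c))) ⟩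
      suc (dist u′ c + dist c v) ≤⟨ s≤s (walk-through (sep ∘ step (x≢y⇒x∉⁅y⁆ u≢c) e) u′≢c w) ⟩
      suc k                      ∎
      where open ≤-Reasoning

  triangle-closure : ∀ {a b c u} → E A a b → E A b c → E A c a → E A u a → E A u b → u ≢ c → E A u c
  triangle-closure {a} {b} {c} {u} eab ebc eca eua eub u≢c with E? A u c
  ... | yes euc = euc
  ... | no ¬euc = contradiction (step (∉a (E⇒≢ eua)) eub (step (∉a (E⇒≢ (E-sym eab))) ebc (here (∉a (E⇒≢ eca)))))
                                (cut eua (E-sym eca) u≢c ¬euc)
    where
    ∉a : ∀ {w} → w ≢ a → w ∉ ⁅ a ⁆
    ∉a = x≢y⇒x∉⁅y⁆

  separates-toward : ∀ {x c a w} → E A c a → dist x a < dist x c → E A c w → w ≢ a → ¬ E A w a → Separates A c w x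
  separates-toward eca lt ecw w≢a ¬ewa r =
    cut (E-sym ecw) eca w≢a ¬ewa (reach-trans r (reach-sym E-sym (reach-toward< lt)))

  same-side⇒closer : ∀ {c u a} → E A c a → Reach A ⁅ c ⁆ u a → dist u a ≤ dist u c
  same-side⇒closer {c} {u} {a} eca r with dist u c in duc
  ... | zero = contradiction (dist≡0⇒≡ {u} {c} duc) (x∉⁅y⁆⇒x≢y (reach-start∉ r))
  ... | suc k with closer-neighbour u c duc
  ...   | w , ecw , duw with w ≟ a
  ...     | yes refl = ≤-trans (≤-reflexive duw) (n≤1+n k)
  ...     | no w≢a with E? A w a
  ...       | yes ewa = subst (λ j → dist u a ≤ suc j) duw (dist-step u ewa)
  ...       | no ¬ewa = contradiction (reach-trans (reach-toward< (≡∧≡suc⇒< duw duc)) r)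
                                      (cut (E-sym ecw) eca w≢a ¬ewa)

  Equidistant : Fin n → Fin n → Fin n → Set
  Equidistant x y z = dist x z ≡ dist y z

  equidistant? : ∀ x y z → Dec (Equidistant x y z)
  equidistant? x y z = dist x z ≟ℕ dist y z

  equidistant⇒≢ : ∀ {x y z} → x ≢ y → Equidistant x y z → z ≢ x
  equidistant⇒≢ {x} {y} x≢y eq refl = x≢y (sym (dist≡0⇒≡ {y} {x} (trans (sym eq) (dist-refl x))))

  InP-intro : ∀ {x y c u} → x ≢ y → Equidistant x y c → u ≢ c → Separates A c u x → Separates A c u y → InP A x y
  InP-intro {x} {y} {c} {u} x≢y eq u≢c sep-x sep-y =
    x≢y , dist x c , ≢⇒0<dist (≢-sym c≢x) , ⁅ c ⁆ ,
    (λ z z∈ → on-sphere (x∈⁅y⁆⇒x≡y c z∈)) ,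
    (u , x , ∉c u≢c , ∉c (≢-sym c≢x) , sep-x) ,
    u , ∉c u≢c , sep-x , sep-y
    where
    c≢x : c ≢ x
    c≢x = equidistant⇒≢ x≢y eq
    ∉c : ∀ {w} → w ≢ c → w ∉ ⁅ c ⁆
    ∉c = x≢y⇒x∉⁅y⁆
    on-sphere : ∀ {z} → z ≡ c → Dist A x z (dist x c) × Dist A y z (dist x c)
    on-sphere refl = dist-Dist x _ , subst (Dist A y _) (sym eq) (dist-Dist y _)

  -- On x's side of c, c′ would be nearer to x (through a) than to y (through c).
  equidistant-beyond-cut : ∀ {x y c a c′} → E A c a → dist x a < dist x c → Equidistant x y c →
                           Separates A c x y → Equidistant x y c′ → c′ ≢ c → Separates A c c′ x
  equidistant-beyond-cut {x} {y} {c} {a} {c′} eca lt eqc sep-xy eqc′ c′≢c r = <-irrefl refl (begin-strict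
    dist x c′             ≤⟨ dist-triangle x a c′ ⟩
    dist x a + dist a c′  ≡⟨ cong (dist x a +_) (dist-sym a c′) ⟩
    dist x a + dist c′ a  ≤⟨ +-monoʳ-≤ (dist x a) (same-side⇒closer eca c′-reaches-a) ⟩
    dist x a + dist c′ c  <⟨ +-monoˡ-< (dist c′ c) lt ⟩
    dist x c + dist c′ c  ≡⟨ cong₂ _+_ eqc (dist-sym c′ c) ⟩
    dist y c + dist c c′  ≤⟨ separated⇒dist-through sep-yc′ y≢c ⟩
    dist y c′             ≡⟨ sym eqc′ ⟩
    dist x c′             ∎)
    where
    open ≤-Reasoning
    c′-reaches-a : Reach A ⁅ c ⁆ c′ a
    c′-reaches-a = reach-trans r (reach-sym E-sym (reach-toward< lt))
    sep-yc′ : Separates A c y c′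
    sep-yc′ r′ = sep-xy (reach-sym E-sym (reach-trans r′ r))
    y≢c : y ≢ c
    y≢c refl = n≮0 (subst (dist x a <_) (trans eqc (dist-refl y)) lt)

  InP-of-nonadjacent-parents : ∀ {x y c a b c′} → x ≢ y → Equidistant x y c →
    E A c a → dist x a < dist x c → E A c b → dist y b < dist y c → a ≢ b → ¬ E A a b →
    Equidistant x y c′ → c′ ≢ c → InP A x y
  InP-of-nonadjacent-parents {x} {y} {c} x≢y eqc eca lta ecb ltb a≢b ¬eab eqc′ c′≢c =
    InP-intro x≢y eqc c′≢c (equidistant-beyond-cut eca lta eqc sep-xy eqc′ c′≢c)
                          (equidistant-beyond-cut ecb ltb (sym eqc) (sep-xy ∘ reach-sym E-sym) (sym eqc′) c′≢c)
    where
    sep-xy : Separates A c x y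
    sep-xy r = separates-toward eca lta ecb (≢-sym a≢b) (¬eab ∘ E-sym)
                 (reach-trans (reach-toward< ltb) (reach-sym E-sym r))

  -- The neighbour a′ of a towards x is either adjacent to t, hence by triangle closure to b,
  -- which is too far from x; or not, and then a would separate a′ from t although both reach x avoiding a.
  common-neighbour-dist≢ : ∀ {x a b t m} → E A a b → E A t a → E A t b →
                           dist x a ≡ m → dist x b ≡ suc m → dist x t ≢ m
  common-neighbour-dist≢ {x} {a} {b} {t} {zero} eab eta etb dxa dxb dxt =
    E⇒≢ eta (trans (sym (dist≡0⇒≡ {x} {t} dxt)) (dist≡0⇒≡ {x} {a} dxa))
  common-neighbour-dist≢ {x} {a} {b} {t} {suc m} eab eta etb dxa dxb dxt with closer-neighbour x a dxa
  ... | a′ , eaa′ , dxa′ with E? A a′ t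
  ...   | yes ea′t = 1+n≰n (begin
          suc (suc m)       ≡⟨ sym dxb ⟩
          dist x b          ≤⟨ dist-step x (triangle-closure (E-sym eta) etb (E-sym eab) (E-sym eaa′) ea′t a′≢b) ⟩
          suc (dist x a′)   ≡⟨ cong suc dxa′ ⟩
          suc m             ∎)
    where
    open ≤-Reasoning
    a′≢b : a′ ≢ b
    a′≢b refl = <-irrefl (trans (sym dxa′) dxb) (m<n⇒m<1+n (n<1+n m))
  ...   | no ¬ea′t = cut (E-sym eaa′) (E-sym eta) a′≢t ¬ea′t
                       (reach-trans (reach-toward< {x} (≡∧≡suc⇒< dxa′ dxa))
                                    (reach-sym E-sym (reach-toward {x} (E⇒≢ eta) (≤-reflexive (trans dxt (sym dxa))))))
    where
    a′≢t : a′ ≢ t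
    a′≢t refl = 1+n≰n (≤-reflexive (trans (sym dxt) dxa′))

  squeeze-level : ∀ {x p t q m} → E A p t → dist x p ≡ m → E A t q → dist x q ≡ suc m →
                  dist x t ≢ m → dist x t ≡ suc m
  squeeze-level {x} {p} {t} {q} ept dxp etq dxq dxt≢m =
    ≤-antisym (subst (λ j → dist x t ≤ suc j) dxp (dist-step x ept))
              (≤∧≢⇒< (s≤s⁻¹ (subst (_≤ suc (dist x t)) dxq (dist-step x etq))) (≢-sym dxt≢m))

  common-neighbour-dist : ∀ {x a b t m} → E A a b → E A t a → E A t b →
                          dist x a ≡ m → dist x b ≡ suc m → dist x t ≡ suc m
  common-neighbour-dist {x} eab eta etb dxa dxb =
    squeeze-level {x} (E-sym eta) dxa etb dxb (common-neighbour-dist≢ {x} eab eta etb dxa dxb)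

  -- a separates y from v, so the route from y to v passes through a, where x is already ahead.
  closer-via-gate : ∀ {x y a b h v} → E A a b → dist x a < dist y a → dist y b < dist y a →
                    E A a h → dist v h < dist v a → h ≢ b → ¬ E A h b → dist x v < dist y v
  closer-via-gate {x} {y} {a} {b} {h} {v} eab lxa lyb eah lvh h≢b ¬ehb = begin-strict
    dist x v            ≤⟨ dist-triangle x a v ⟩
    dist x a + dist a v <⟨ +-monoˡ-< (dist a v) lxa ⟩
    dist y a + dist a v ≤⟨ separated⇒dist-through sep-yv y≢a ⟩
    dist y v            ∎
    where
    open ≤-Reasoning
    sep-yv : Separates A a y v
    sep-yv r = cut (E-sym eah) eab h≢b ¬ehb
      (reach-trans (reach-toward< lvh) (reach-trans (reach-sym E-sym r) (reach-sym E-sym (reach-toward< lyb))))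
    y≢a : y ≢ a
    y≢a refl = n≮0 (subst (dist y b <_) (dist-refl y) lyb)

  module AdjacentParents {x y a b : Fin n} {m : ℕ} (x≢y : x ≢ y) (eab : E A a b)
           (dxa : dist x a ≡ m) (dyb : dist y b ≡ m) (dxb : dist x b ≡ suc m) (dya : dist y a ≡ suc m) where

    InK : Fin n → Set
    InK w = w ≡ a ⊎ w ≡ b ⊎ (E A w a × E A w b)

    InK? : Decidable InK
    InK? w = (w ≟ a) ⊎-dec ((w ≟ b) ⊎-dec (E? A w a ×-dec E? A w b))

    K : Subset n
    K = toSubset InK?

    module _ {t} (eta : E A t a) (etb : E A t b) where

      dxt : dist x t ≡ suc m
      dxt = common-neighbour-dist {x} eab eta etb dxa dxb

      dyt : dist y t ≡ suc m
      dyt = common-neighbour-dist {y} (E-sym eab) etb eta dyb dya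

      common-equidistant : Equidistant x y t
      common-equidistant = trans dxt (sym dyt)

      x-closer : dist x a < dist x t
      x-closer = ≡∧≡suc⇒< dxa dxt

      y-closer : dist y b < dist y t
      y-closer = ≡∧≡suc⇒< dyb dyt

    InP-of-exit : ∀ {c u} → E A c a → E A c b → E A c u → ¬ InK u → InP A x y
    InP-of-exit {c} {u} eca ecb ecu u∉K =
      InP-intro x≢y (common-equidistant eca ecb) (≢-sym (E⇒≢ ecu))
        (separates-toward eca (x-closer eca ecb) ecu (u∉K ∘ inj₁) ¬eua)
        (separates-toward ecb (y-closer eca ecb) ecu (u∉K ∘ inj₂ ∘ inj₁) ¬eub)
      where
      ¬eua : ¬ E A u a
      ¬eua eua = u∉K (inj₂ (inj₂ (eua , triangle-closure eca eab (E-sym ecb) (E-sym ecu) eua (u∉K ∘ inj₂ ∘ inj₁))))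
      ¬eub : ¬ E A u b
      ¬eub eub = u∉K (inj₂ (inj₂ (triangle-closure ecb (E-sym eab) (E-sym eca) (E-sym ecu) eub (u∉K ∘ inj₁) , eub)))

    outside-K : ∀ {v} → ¬ InK v → InP A x y ⊎ ¬ Equidistant x y v
    outside-K {v} v∉K with argmin (dist v) InK? (a , inj₁ refl)
    ... | g , g∈K , nearest with dist v g in dvg
    ...   | zero = contradiction (subst InK (sym (dist≡0⇒≡ {v} {g} dvg)) g∈K) v∉K
    ...   | suc k with closer-neighbour v g dvg
    ...     | h , egh , dvh = exit-through g∈K
      where
      lvh : dist v h < dist v g
      lvh = ≡∧≡suc⇒< dvh dvg
      h∉K : ¬ InK h
      h∉K h∈K = <⇒≱ (subst (dist v h <_) dvg lvh) (nearest h∈K)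
      exit-through : InK g → InP A x y ⊎ ¬ Equidistant x y v
      exit-through (inj₁ refl) = inj₂ λ eq → <-irrefl eq
        (closer-via-gate {x} {y} {v = v} eab (≡∧≡suc⇒< dxa dya) (≡∧≡suc⇒< dyb dya)
           egh lvh (h∉K ∘ inj₂ ∘ inj₁) (λ ehb → h∉K (inj₂ (inj₂ (E-sym egh , ehb)))))
      exit-through (inj₂ (inj₁ refl)) = inj₂ λ eq → <-irrefl (sym eq)
        (closer-via-gate {y} {x} {v = v} (E-sym eab) (≡∧≡suc⇒< dyb dxb) (≡∧≡suc⇒< dxa dxb)
           egh lvh (h∉K ∘ inj₁) (λ eha → h∉K (inj₂ (inj₂ (eha , E-sym egh)))))
      exit-through (inj₂ (inj₂ (ega , egb))) = inj₁ (InP-of-exit ega egb egh h∉K)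

    K-clique : ∀ {p q} → InK p → InK q → p ≢ q → E A p q
    K-clique (inj₁ refl)               (inj₁ refl)               p≢q = contradiction refl p≢q
    K-clique (inj₁ refl)               (inj₂ (inj₁ refl))        _   = eab
    K-clique (inj₁ refl)               (inj₂ (inj₂ (eqa , _)))   _   = E-sym eqa
    K-clique (inj₂ (inj₁ refl))        (inj₁ refl)               _   = E-sym eab
    K-clique (inj₂ (inj₁ refl))        (inj₂ (inj₁ refl))        p≢q = contradiction refl p≢q
    K-clique (inj₂ (inj₁ refl))        (inj₂ (inj₂ (_ , eqb)))   _   = E-sym eqb
    K-clique (inj₂ (inj₂ (epa , _)))   (inj₁ refl)               _   = epa
    K-clique (inj₂ (inj₂ (_ , epb)))   (inj₂ (inj₁ refl))        _   = epb
    K-clique (inj₂ (inj₂ (epa , epb))) (inj₂ (inj₂ (eqa , eqb))) p≢q = triangle-closure eab (E-sym eqb) eqa epa epb p≢q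

    ∈K⁺ : ∀ {w} → InK w → w ∈ K
    ∈K⁺ = ∈-toSubset⁺ InK?

    ∈K⁻ : ∀ {w} → w ∈ K → InK w
    ∈K⁻ = ∈-toSubset⁻ InK?

    K-isMaxClique : IsMaxClique A K
    K-isMaxClique =
      (λ p q p∈K q∈K → K-clique (∈K⁻ p∈K) (∈K⁻ q∈K)) ,
      (λ w w∉K adjacent → w∉K (∈K⁺ (inj₂ (inj₂ (adjacent a (∈K⁺ (inj₁ refl)) , adjacent b (∈K⁺ (inj₂ (inj₁ refl))))))))

    deg≡∣K∣∸1 : ∀ {c} → InK c → (∀ {u} → E A c u → InK u) → deg A c ≡ ∣ K ∣ ∸ 1
    deg≡∣K∣∸1 {c} c∈K closed = begin
      ∣ tabulate (A c) ∣  ≡⟨ cong ∣_∣ (⊆-antisym neighbours⊆K-c K-c⊆neighbours) ⟩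
      ∣ K - c ∣           ≡⟨ cong (_∸ 1) (∣p∣≡1+∣p-x∣ (∈K⁺ c∈K)) ⟨
      ∣ K ∣ ∸ 1           ∎
      where
      open ≡-Reasoning
      neighbours⊆K-c : tabulate (A c) ⊆ K - c
      neighbours⊆K-c w∈ = x∈p∧x≢y⇒x∈p-y (∈K⁺ (closed (∈-tabulate⁻ w∈))) (≢-sym (E⇒≢ (∈-tabulate⁻ w∈)))
      K-c⊆neighbours : K - c ⊆ tabulate (A c)
      K-c⊆neighbours {w} w∈ = ∈-tabulate⁺ (K-clique c∈K (∈K⁻ (p─q⊆p K ⁅ c ⁆ w∈)) λ { refl → x∉p-x K w∈ })

    tagged : ∀ {z z′} → E A z a → E A z b → E A z′ a → E A z′ b → z ≢ z′ →
             (∀ {u} → E A z u → InK u) → (∀ {u} → E A z′ u → InK u) → Tagged A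
    tagged {z} {z′} eza ezb ez′a ez′b z≢z′ closed closed′ =
      K , K-isMaxClique ,
      3≤∣p∣ (∈K⁺ (inj₁ refl)) (∈K⁺ (inj₂ (inj₁ refl))) (∈K⁺ z∈K) (E⇒≢ eab) (≢-sym (E⇒≢ eza)) (≢-sym (E⇒≢ ezb)) ,
      z , z′ , ∈K⁺ z∈K , ∈K⁺ z′∈K , z≢z′ , deg≡∣K∣∸1 z∈K closed , deg≡∣K∣∸1 z′∈K closed′
      where
      z∈K : InK z
      z∈K = inj₂ (inj₂ (eza , ezb))
      z′∈K : InK z′
      z′∈K = inj₂ (inj₂ (ez′a , ez′b))

    closed-or-InP : ∀ {c} → E A c a → E A c b → InP A x y ⊎ (∀ {u} → E A c u → InK u)
    closed-or-InP {c} eca ecb with any? (λ u → E? A c u ×-dec ¬? (InK? u))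
    ... | yes (u , ecu , u∉K) = inj₁ (InP-of-exit eca ecb ecu u∉K)
    ... | no ∄exit            = inj₂ λ {u} ecu → decidable-stable (InK? u) (λ u∉K → ∄exit (u , ecu , u∉K))

    InP-or-tagged : ∀ {z z′} → E A z a → E A z b → Equidistant x y z′ → z′ ≢ z → InP A x y ⊎ Tagged A
    InP-or-tagged {z} {z′} eza ezb eqz′ z′≢z with InK? z′
    ... | no z′∉K                  = map₂ (contradiction eqz′) (outside-K z′∉K)
    ... | yes (inj₁ refl)          = contradiction eqz′ (<⇒≢ (≡∧≡suc⇒< dxa dya))
    ... | yes (inj₂ (inj₁ refl))   = contradiction (sym eqz′) (<⇒≢ (≡∧≡suc⇒< dyb dxb))
    ... | yes (inj₂ (inj₂ (ez′a , ez′b))) with closed-or-InP eza ezb | closed-or-InP ez′a ez′b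
    ...   | inj₁ inP    | _            = inj₁ inP
    ...   | inj₂ _      | inj₁ inP     = inj₁ inP
    ...   | inj₂ closed | inj₂ closed′ = inj₂ (tagged eza ezb ez′a ez′b (≢-sym z′≢z) closed closed′)

  InP-or-tagged-from-nearest : ∀ {x y z z′ m} → x ≢ y → Equidistant x y z → dist x z ≡ suc m →
    (∀ {w} → Equidistant x y w → dist x w ≢ m) → Equidistant x y z′ → z′ ≢ z → InP A x y ⊎ Tagged A
  InP-or-tagged-from-nearest {x} {y} {z} {z′} {m} x≢y eqz dxz none-lower eqz′ z′≢z
    with closer-neighbour x z dxz | closer-neighbour y z (trans (sym eqz) dxz)
  ... | a , eza , dxa | b , ezb , dyb with E? A a b
  ...   | no ¬eab = inj₁ (InP-of-nonadjacent-parents x≢y eqz eza (≡∧≡suc⇒< dxa dxz)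
                            ezb (≡∧≡suc⇒< dyb (trans (sym eqz) dxz)) a≢b ¬eab eqz′ z′≢z)
    where
    a≢b : a ≢ b
    a≢b refl = none-lower (trans dxa (sym dyb)) dxa
  ...   | yes eab = AdjacentParents.InP-or-tagged x≢y eab dxa dyb
                      (squeeze-level {x} eab dxa (E-sym ezb) dxz (λ dxb → none-lower (trans dxb (sym dyb)) dxb))
                      (squeeze-level {y} (E-sym eab) dyb (E-sym eza) (trans (sym eqz) dxz)
                                     (λ dya → none-lower (trans dxa (sym dya)) dxa))
                      eza ezb eqz′ z′≢z

  InP-or-tagged : ∀ {x y z₁ z₂} → x ≢ y → Equidistant x y z₁ → Equidistant x y z₂ → z₁ ≢ z₂ → InP A x y ⊎ Tagged A
  InP-or-tagged {x} {y} {z₁} {z₂} x≢y eq₁ eq₂ z₁≢z₂ with argmin (dist x) (equidistant? x y) (z₁ , eq₁)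
  ... | z , eqz , nearest with witness-≢ eq₁ eq₂ z₁≢z₂ z | dist x z in dxz
  ...   | _ , _ , _        | zero  = contradiction (dist≡0⇒≡ {x} {z} dxz) (≢-sym (equidistant⇒≢ x≢y eqz))
  ...   | _ , eqz′ , z′≢z  | suc m =
    InP-or-tagged-from-nearest x≢y eqz dxz (λ eqw dxw → 1+n≰n (subst₂ _≤_ dxz dxw (nearest eqw))) eqz′ z′≢z

  InP-or-tagged-or-resolving : ∀ {x y} → x ≢ y →
    InP A x y ⊎ Tagged A ⊎ Σ (Subset n) (λ D → (∀ z → z ∈ D → InD A x y z) × n ∸ 1 ≤ ∣ D ∣)
  InP-or-tagged-or-resolving {x} {y} x≢y
    with any? (λ z₁ → any? (λ z₂ → equidistant? x y z₁ ×-dec equidistant? x y z₂ ×-dec ¬? (z₁ ≟ z₂)))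
  ... | yes (z₁ , z₂ , eq₁ , eq₂ , z₁≢z₂) = [ inj₁ , inj₂ ∘ inj₁ ]′ (InP-or-tagged x≢y eq₁ eq₂ z₁≢z₂)
  ... | no ∄pair = inj₂ (inj₂ (D , D-resolves , n∸1≤∣p∣ (λ i∉D j∉D → at-most-one (∉D i∉D) (∉D j∉D))))
    where
    resolves? : Decidable (λ z → ¬ Equidistant x y z)
    resolves? z = ¬? (equidistant? x y z)
    D : Subset n
    D = toSubset resolves?
    D-resolves : ∀ z → z ∈ D → InD A x y z
    D-resolves z z∈D _ _ Dxz Dyz eq =
      ∈-toSubset⁻ resolves? z∈D (trans (sym (Dist⇒≡dist Dxz)) (trans eq (Dist⇒≡dist Dyz)))
    ∉D : ∀ {z} → z ∉ D → Equidistant x y z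
    ∉D {z} z∉D = decidable-stable (equidistant? x y z) (z∉D ∘ ∈-toSubset⁺ resolves?)
    at-most-one : ∀ {z₁ z₂} → Equidistant x y z₁ → Equidistant x y z₂ → z₁ ≡ z₂
    at-most-one {z₁} {z₂} eq₁ eq₂ = decidable-stable (z₁ ≟ z₂) (λ z₁≢z₂ → ∄pair (z₁ , z₂ , eq₁ , eq₂ , z₁≢z₂))

proposition3p17 : (n : ℕ) (A : Adj n) → IsBlockGraph A → NonElementary A → ¬ Tagged A →
    (x y : Fin n) → x ≢ y →
    InP A x y ⊎ Σ (Subset n) (λ D → (∀ z → z ∈ D → InD A x y z) × n ∸ 1 ≤ ∣ D ∣)
proposition3p17 n A block-graph _ untagged x y x≢y
  with InP-or-tagged-or-resolving (isBlockGraph⇒blockGraph block-graph) x≢y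
... | inj₁ inP               = inj₁ inP
... | inj₂ (inj₁ tagged)    = contradiction tagged untagged
... | inj₂ (inj₂ resolving) = inj₂ resolving
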